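{- Let ${\bf a}=(a_n)_{n\ge0}$ be a sequence over a finite totally ordered alphabet, and let ${\bf b}=(b_n)_{n\ge0}$ be the lexicographically least sequence in the orbit closure of ${\bf a}$. Then for every $i\ge0$ and every letter $c$, $b_i=c$ if and only if there exists $j\ge 0$ such that $a_{j+i}=c$ and $a_l a_{l+1}\cdots a_{l+i}\ge a_j a_{j+1}\cdots a_{j+i}$ (lexicographically) for all $l\ge 0$.
   Context: The orbit of ${\bf a}$ is the set of its shifts $\{(a_{n+i})_{n\ge0}: i\ge0\}$; its orbit closure is the topological closure of the orbit in the product topology (two sequences are close if they agree on a long prefix). Equivalently, a sequence ${\bf b}$ lies in the orbit closure of ${\bf a}$ iff every finite prefix of ${\bf b}$ is a factor of ${\bf a}$. Words of equal length and infinite sequences are compared in lexicographic order induced by the order on the alphabet. -}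

module Defs where

open import Data.Nat using (ℕ; _+_; _<_)
open import Data.Fin as Fin using (Fin)
open import Data.Product using (∃; _×_)
open import Data.Sum using (_⊎_)
open import Relation.Binary.PropositionalEquality using (_≡_)

-- The finite totally ordered alphabet is Fin k with its natural order.
Seq : ℕ → Set
Seq k = ℕ → Fin k

-- b lies in the orbit closure of a: every finite prefix of b is a factor of a.
InOrbitClosure : {k : ℕ} → Seq k → Seq k → Set
InOrbitClosure b a = ∀ (n : ℕ) → ∃ λ (j : ℕ) → ∀ (t : ℕ) → t < n → b t ≡ a (j + t)

LexLeq : {k : ℕ} → Seq k → Seq k → Set
LexLeq b c = (∀ (n : ℕ) → b n ≡ c n)
           ⊎ (∃ λ (n : ℕ) → (∀ (t : ℕ) → t < n → b t ≡ c t) × (b n Fin.< c n))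

IsLexLeastInOrbitClosure : {k : ℕ} → Seq k → Seq k → Set
IsLexLeastInOrbitClosure {k} b a =
  InOrbitClosure b a × (∀ (c : Seq k) → InOrbitClosure c a → LexLeq b c)

FactorLeq : {k : ℕ} → Seq k → (m j l : ℕ) → Set
FactorLeq a m j l = (∀ (t : ℕ) → t < m → a (j + t) ≡ a (l + t))
                  ⊎ (∃ λ (t : ℕ) → t < m × (∀ (s : ℕ) → s < t → a (j + s) ≡ a (l + s))
                                   × (a (j + t) Fin.< a (l + t)))

module Submission where

-- Write b[..i] for the prefix b₀⋯bᵢ and a[j..j+i] for the factor of a
-- of length i+1 starting at j.
-- Every shift of a lies in the orbit closure, so by truncation b[..i] is below
-- every factor a[l..l+i]; and b[..i] = a[m..m+i] for some m because b is in
-- the orbit closure.  Hence a[m..m+i] is a least factor and its last letter is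
-- bᵢ (⇒).  Conversely, if a[j..j+i] is a least factor then it lies below
-- a[m..m+i] = b[..i], which lies below it, so the two coincide by
-- antisymmetry and a_{j+i} = bᵢ (⇐).

open import Defs
open import Data.Nat using (ℕ; _+_; suc; _<_; _<?_)
open import Data.Nat.Properties using (<-cmp; <-trans; <-≤-trans; ≮⇒≥; n<1+n)
open import Data.Fin as F using (Fin)
import Data.Fin.Properties as FP
open import Data.Product using (∃; _×_; _,_; proj₁; proj₂)
open import Data.Sum using (_⊎_; inj₁; inj₂)
open import Relation.Nullary using (yes; no; contradiction)
open import Relation.Binary using (Tri; tri<; tri≈; tri>)
open import Function.Bundles using (_⇔_; mk⇔)
open import Relation.Binary.PropositionalEquality using (_≡_; refl; sym; trans; subst)

shift : {k : ℕ} → Seq k → ℕ → Seq k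
shift a j n = a (j + n)

shift∈orbitClosure : {k : ℕ} (a : Seq k) (j : ℕ) → InOrbitClosure (shift a j) a
shift∈orbitClosure a j n = j , λ _ _ → refl

PrefixEq : {k : ℕ} → ℕ → Seq k → Seq k → Set
PrefixEq n u v = ∀ (t : ℕ) → t < n → u t ≡ v t

prefixEq-refl : {k n : ℕ} {u : Seq k} → PrefixEq n u u
prefixEq-refl _ _ = refl

prefixEq-sym : {k n : ℕ} {u v : Seq k} → PrefixEq n u v → PrefixEq n v u
prefixEq-sym u≡v t t<n = sym (u≡v t t<n)

-- The prefix of length n of u is lexicographically at most that of v.
-- FactorLeq a n j l is by definition PrefixLeq n (shift a j) (shift a l).
PrefixLeq : {k : ℕ} → ℕ → Seq k → Seq k → Set
PrefixLeq n u v = PrefixEq n u v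
                ⊎ (∃ λ (t : ℕ) → t < n × PrefixEq t u v × (u t F.< v t))

lexLeq⇒prefixLeq : {k : ℕ} {u v : Seq k} → LexLeq u v → ∀ n → PrefixLeq n u v
lexLeq⇒prefixLeq (inj₁ u≡v) n = inj₁ λ t _ → u≡v t
lexLeq⇒prefixLeq (inj₂ (d , u≡v<d , ud<vd)) n with d <? n
... | yes d<n = inj₂ (d , d<n , u≡v<d , ud<vd)
... | no d≮n  = inj₁ λ t t<n → u≡v<d t (<-≤-trans t<n (≮⇒≥ d≮n))

prefixLeq-transport : {k n : ℕ} {u u′ v v′ : Seq k} →
  PrefixEq n u u′ → PrefixEq n v v′ → PrefixLeq n u v → PrefixLeq n u′ v′
prefixLeq-transport u≡u′ v≡v′ (inj₁ u≡v) =
  inj₁ λ t t<n → trans (sym (u≡u′ t t<n)) (trans (u≡v t t<n) (v≡v′ t t<n))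
prefixLeq-transport {u′ = u′} {v′ = v′} u≡u′ v≡v′ (inj₂ (t , t<n , u≡v<t , ut<vt)) =
  inj₂ (t , t<n , agree , subst (F._< v′ t) (u≡u′ t t<n) (subst (_ F.<_) (v≡v′ t t<n) ut<vt))
  where
  agree : PrefixEq t u′ v′
  agree s s<t = let s<n = <-trans s<t t<n in
    trans (sym (u≡u′ s s<n)) (trans (u≡v<t s s<t) (v≡v′ s s<n))

-- Antisymmetry: mutually comparable prefixes are equal.  Two strict
-- comparisons disagree at their first difference, which must be the same
-- position, where the letters would be both < and >.
prefixLeq-antisym : {k n : ℕ} {u v : Seq k} →
  PrefixLeq n u v → PrefixLeq n v u → PrefixEq n u v
prefixLeq-antisym (inj₁ u≡v) _ = u≡v
prefixLeq-antisym (inj₂ (t , t<n , _ , ut<vt)) (inj₁ v≡u) =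
  contradiction ut<vt (FP.<-irrefl (sym (v≡u t t<n)))
prefixLeq-antisym {n = n} {u} {v} (inj₂ (t , _ , u≡v<t , ut<vt)) (inj₂ (s , _ , v≡u<s , vs<us)) =
  impossible (<-cmp t s)
  where
  impossible : Tri (t < s) (t ≡ s) (s < t) → PrefixEq n u v
  impossible (tri< t<s _ _)  = contradiction ut<vt (FP.<-irrefl (sym (v≡u<s t t<s)))
  impossible (tri≈ _ refl _) = contradiction vs<us (FP.<-asym ut<vt)
  impossible (tri> _ _ s<t)  = contradiction vs<us (FP.<-irrefl (sym (u≡v<t s s<t)))

lemma4 : (k : ℕ) (a b : Seq k) → IsLexLeastInOrbitClosure b a →
    ∀ (i : ℕ) (c : Fin k) →
      (b i ≡ c) ⇔ (∃ λ (j : ℕ) → (a (j + i) ≡ c) × (∀ (l : ℕ) → FactorLeq a (suc i) j l))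
lemma4 k a b (b∈ , b-least) i c = mk⇔ forward backward
  where
  b-below : ∀ l → PrefixLeq (suc i) b (shift a l)
  b-below l = lexLeq⇒prefixLeq (b-least _ (shift∈orbitClosure a l)) (suc i)

  m : ℕ
  m = proj₁ (b∈ (suc i))
  b≡factorₘ : PrefixEq (suc i) b (shift a m)
  b≡factorₘ = proj₂ (b∈ (suc i))

  forward : b i ≡ c → ∃ λ j → (a (j + i) ≡ c) × (∀ l → FactorLeq a (suc i) j l)
  forward bi≡c = m , trans (sym (b≡factorₘ i (n<1+n i))) bi≡c
               , λ l → prefixLeq-transport b≡factorₘ prefixEq-refl (b-below l)

  backward : (∃ λ j → (a (j + i) ≡ c) × (∀ l → FactorLeq a (suc i) j l)) → b i ≡ c
  backward (j , aj+i≡c , factorⱼ-least) = trans (b≡factorⱼ i (n<1+n i)) aj+i≡c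
    where
    factorⱼ≤b : PrefixLeq (suc i) (shift a j) b
    factorⱼ≤b = prefixLeq-transport prefixEq-refl (prefixEq-sym b≡factorₘ) (factorⱼ-least m)
    b≡factorⱼ : PrefixEq (suc i) b (shift a j)
    b≡factorⱼ = prefixLeq-antisym (b-below j) factorⱼ≤b
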